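{- Let $E=\sum_{i=1}^{\ell}a_i\cdot 2^{x_i}+\mu\cdot y+\mu\cdot d$, where $a_1,\dots,a_\ell\in\mathbb{Z}$ and $\mu,d\in\mathbb{N}$. Let $M,k\in\mathbb{N}$ with $M\ge\max\big(1+2\log_2(\sum_{i=1}^{\ell}|a_i|+k\mu),\ 4\log_2(\mu)+8,\ d\big)$. Let $\psi(x_1,\dots,x_\ell,y)$, with $y$ ranging over $\mathbb{Z}$ and $x_1,\dots,x_\ell$ ranging over $\mathbb{N}$, be the formula $-k\cdot2^{x_1}\le y\le k\cdot 2^{x_1}\wedge\bigwedge_{i=1}^{\ell-1}(x_{i+1}\sim_i x_i+d_i)$, where each pair $(\sim_i,d_i)$ is either $(\ge,M)$ or $(=,g)$ for some $g\in\{0,\dots,M-1\}$. Let $\sim\in\{\le,=\}$ and $b=\mu\cdot(k+d)$. Then there is an expression $E'$ in the set $\{0,1\}\cup\{a\cdot2^{x_1}+\mu y+\mu d : a\in\{ -b,\dots,b\}\}$ such that every assignment satisfying $\psi$ satisfies $(E\sim0\iff E'\sim0)$. -}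

module Defs where

open import Data.Nat as ℕ using (ℕ; zero; suc; _^_)
open import Data.Integer as ℤ using (ℤ; +_; -_; ∣_∣)
open import Data.Fin using (Fin; zero; suc; inject₁)
open import Data.Product using (_×_)
open import Function.Bundles using (_⇔_)

sumℤ : ∀ {n} → (Fin n → ℤ) → ℤ
sumℤ {zero}  f = + 0
sumℤ {suc n} f = f zero ℤ.+ sumℤ (λ i → f (suc i))

sumℕ : ∀ {n} → (Fin n → ℕ) → ℕ
sumℕ {zero}  f = 0
sumℕ {suc n} f = f zero ℕ.+ sumℕ (λ i → f (suc i))

pow2 : ℕ → ℤ
pow2 x = + (2 ^ x)

data Cmp : Set where
  le eq : Cmp

_∼0[_] : ℤ → Cmp → Set
e ∼0[ le ] = e ℤ.≤ + 0
e ∼0[ eq ] = e ≡ + 0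
  where open import Relation.Binary.PropositionalEquality using (_≡_)

data Constr (M : ℕ) : Set where
  geM : Constr M
  eqg : (g : ℕ) → g ℕ.< M → Constr M

holds : ∀ {M} → Constr M → ℕ → ℕ → Set
holds {M} geM      xi' xi = xi' ℕ.≥ xi ℕ.+ M
holds     (eqg g _) xi' xi = xi' ≡ xi ℕ.+ g
  where open import Relation.Binary.PropositionalEquality using (_≡_)

E : ∀ {n} → (Fin (suc n) → ℤ) → ℕ → ℕ → (Fin (suc n) → ℕ) → ℤ → ℤ
E a μ d x y = sumℤ (λ i → a i ℤ.* pow2 (x i)) ℤ.+ + μ ℤ.* y ℤ.+ + μ ℤ.* + d

ψ : ∀ {n M} → ℕ → (Fin n → Constr M) → (Fin (suc n) → ℕ) → ℤ → Set
ψ {n} k c x y =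
  ((- (+ k ℤ.* pow2 (x zero)) ℤ.≤ y) × (y ℤ.≤ + k ℤ.* pow2 (x zero)))
  × ((i : Fin n) → holds (c i) (x (suc i)) (x (inject₁ i)))

data Expr (b : ℕ) : Set where
  const0 const1 : Expr b
  lin : (a : ℤ) → - (+ b) ℤ.≤ a → a ℤ.≤ + b → Expr b

evalE' : ∀ {n b} → ℕ → ℕ → Expr b → (Fin (suc n) → ℕ) → ℤ → ℤ
evalE' μ d const0        x y = + 0
evalE' μ d const1        x y = + 1
evalE' μ d (lin a _ _)   x y = a ℤ.* pow2 (x zero) ℤ.+ + μ ℤ.* y ℤ.+ + μ ℤ.* + d

{-# OPTIONS --safe #-}
-- Write T = Σ aᵢ 2^{xᵢ} and A = Σ |aᵢ|. Read backwards along the chain of exponents, every tail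
-- of T is either an exact multiple C · 2^{x₁} of its first power (a constraint x_{i+1} = x_i + g
-- only rescales C by 2^g), or has a sign forced with margin m, |T| ≥ m · 2^{x₁}: across a gap
-- x_{i+1} ≥ x_i + M a nonzero multiple of 2^{x_{i+1}} is at least 2^M · 2^{x_i}, and each earlier
-- term aᵢ 2^{xᵢ} uses up at most |aᵢ| of the margin. Starting from margin b + 1, b = μ(k + d),
-- this needs b + 1 + A ≤ 2^M, which is what the bounds on M provide. Under ψ we have
-- |μy + μd| ≤ b · 2^{x₁}, so a forced sign of T, or a multiple with |C| > b, fixes the sign of E
-- and a constant E' ∈ {0, 1} reproduces the comparison; otherwise E' = C · 2^{x₁} + μy + μd = E.
module Submission where

open import Defs
open import Relation.Binary.PropositionalEquality

module ExponentBounds where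
  open import Data.Nat
  open import Data.Nat.Properties
  open import Data.Nat.Tactic.RingSolver
  open import Data.List using (_∷_; [])

  n<2^n : ∀ n → n < 2 ^ n
  n<2^n zero    = z<s
  n<2^n (suc n) = begin-strict
    suc n         ≤⟨ n<2^n n ⟩
    2 ^ n         <⟨ m<m+n (2 ^ n) (m^n>0 2 n) ⟩
    2 ^ n + 2 ^ n ≡⟨ cong (2 ^ n +_) (+-identityʳ (2 ^ n)) ⟨
    2 * 2 ^ n     ∎
    where open ≤-Reasoning

  n*n≤2^[1+n] : ∀ n → n * n ≤ 2 ^ suc n
  n*n≤2^[1+n] zero    = z≤n
  n*n≤2^[1+n] (suc n) = begin
    suc n * suc n         ≡⟨ solve (n ∷ []) ⟩
    n * n + (1 + 2 * n)   ≤⟨ +-mono-≤ (n*n≤2^[1+n] n) (*-monoʳ-< 2 (n<2^n n)) ⟩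
    2 ^ suc n + 2 ^ suc n ≡⟨ cong (2 ^ suc n +_) (+-identityʳ (2 ^ suc n)) ⟨
    2 ^ suc (suc n)       ∎
    where open ≤-Reasoning

  m*m<n*n⇒m<n : ∀ {m n} → m * m < n * n → m < n
  m*m<n*n⇒m<n m²<n² = ≰⇒> (λ n≤m → <⇒≱ m²<n² (*-mono-≤ n≤m n≤m))

  8μ²<2^M : ∀ μ M .{{_ : NonZero μ}} → 256 * μ ^ 4 ≤ 2 ^ M → 8 * (μ * μ) < 2 ^ M
  8μ²<2^M μ M h = begin-strict
    8 * (μ * μ)                     <⟨ *-monoˡ-< (μ * μ) {{m*n≢0 μ μ}} (m≤m+n 9 247) ⟩
    256 * (μ * μ)                   ≤⟨ *-monoʳ-≤ 256 (m≤m*n (μ * μ) (μ * μ) {{m*n≢0 μ μ}}) ⟩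
    256 * (μ * μ * (μ * μ))         ≡⟨ solve (μ ∷ []) ⟩
    256 * (μ * (μ * (μ * (μ * 1)))) ≤⟨ h ⟩
    2 ^ M                           ∎
    where open ≤-Reasoning

  2μM<2^M : ∀ μ M → 256 * μ ^ 4 ≤ 2 ^ M → 2 * (μ * M) < 2 ^ M
  2μM<2^M zero      M _ = m^n>0 2 M
  2μM<2^M μ@(suc _) M h = m*m<n*n⇒m<n (begin-strict
    2 * (μ * M) * (2 * (μ * M)) ≡⟨ square-expand μ M ⟩
    4 * (μ * μ) * (M * M)       ≤⟨ *-monoʳ-≤ (4 * (μ * μ)) (n*n≤2^[1+n] M) ⟩
    4 * (μ * μ) * (2 * 2 ^ M)   ≡⟨ regroup (μ * μ) (2 ^ M) ⟩
    8 * (μ * μ) * 2 ^ M         <⟨ *-monoˡ-< (2 ^ M) {{m^n≢0 2 M}} (8μ²<2^M μ M h) ⟩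
    2 ^ M * 2 ^ M               ∎)
    where
    open ≤-Reasoning
    square-expand : ∀ μ M → 2 * (μ * M) * (2 * (μ * M)) ≡ 4 * (μ * μ) * (M * M)
    square-expand = solve-∀
    regroup : ∀ x y → 4 * x * (2 * y) ≡ 8 * x * y
    regroup = solve-∀

  n≤n^2 : ∀ n → n ≤ n ^ 2
  n≤n^2 zero      = z≤n
  n≤n^2 n@(suc _) = m≤m*n n (n ^ 1) {{m^n≢0 n 1}}

  margin-fits : ∀ A μ d M k → 2 * ((A + k * μ) ^ 2) ≤ 2 ^ M → 256 * μ ^ 4 ≤ 2 ^ M → d ≤ M
              → suc (μ * (k + d)) + A ≤ 2 ^ M
  margin-fits A μ d M k hS hμ d≤M = *-cancelˡ-< 2 _ _ (begin-strict
    2 * (μ * (k + d) + A)          ≡⟨ solve (A ∷ μ ∷ d ∷ k ∷ []) ⟩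
    2 * (A + k * μ) + 2 * (μ * d)  ≤⟨ +-monoˡ-≤ (2 * (μ * d)) 2S≤2^M ⟩
    2 ^ M + 2 * (μ * d)            <⟨ +-monoʳ-< (2 ^ M) 2μd<2^M ⟩
    2 ^ M + 2 ^ M                  ≡⟨ cong (2 ^ M +_) (+-identityʳ (2 ^ M)) ⟨
    2 * 2 ^ M                      ∎)
    where
    open ≤-Reasoning
    2S≤2^M : 2 * (A + k * μ) ≤ 2 ^ M
    2S≤2^M = ≤-trans (*-monoʳ-≤ 2 (n≤n^2 (A + k * μ))) hS
    2μd<2^M : 2 * (μ * d) < 2 ^ M
    2μd<2^M = ≤-<-trans (*-monoʳ-≤ 2 (*-monoʳ-≤ μ d≤M)) (2μM<2^M μ M hμ)

module Dominance where
  open import Data.Nat as ℕ using (ℕ; zero; suc; _^_; s≤s; z≤n)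
  import Data.Nat.Properties as ℕ
  open import Data.Integer using (ℤ; +_; -[1+_]; +[1+_]; -_; _+_; _*_; _≤_; +≤+; -≤+; -≤-; ∣_∣)
  open import Data.Integer.Properties
  open import Data.Integer.Tactic.RingSolver
  open import Data.Fin using (Fin; zero; suc; inject₁)
  open import Data.Product using (Σ; _,_)
  open import Data.Sum using (_⊎_; inj₁; inj₂)
  open import Data.Empty using (⊥-elim)
  open import Function using (_∘_; _⇔_; mk⇔)
  open import Relation.Nullary using (¬_; yes; no)

  -∣i∣≤i : ∀ i → - (+ ∣ i ∣) ≤ i
  -∣i∣≤i (+ n)    = neg-≤-pos
  -∣i∣≤i -[1+ n ] = ≤-refl

  i≤∣i∣ : ∀ i → i ≤ + ∣ i ∣
  i≤∣i∣ (+ n)    = ≤-refl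
  i≤∣i∣ -[1+ n ] = -≤+

  j≤∣i∣⇒j≤i⊎i≤-j : ∀ {j} i → j ℕ.≤ ∣ i ∣ → + j ≤ i ⊎ i ≤ - + j
  j≤∣i∣⇒j≤i⊎i≤-j (+ n)    j≤n   = inj₁ (+≤+ j≤n)
  j≤∣i∣⇒j≤i⊎i≤-j -[1+ n ] j≤1+n = inj₂ (neg-mono-≤ (+≤+ j≤1+n))

  absorb-above : ∀ m a p {t} → + (m ℕ.+ ∣ a ∣) * + p ≤ t → + m * + p ≤ a * + p + t
  absorb-above m a p {t} h = begin
    + m * + p                                 ≡⟨ split (+ m) (+ ∣ a ∣) (+ p) ⟩
    - (+ ∣ a ∣) * + p + + (m ℕ.+ ∣ a ∣) * + p ≤⟨ +-mono-≤ (*-monoʳ-≤-nonNeg (+ p) (-∣i∣≤i a)) h ⟩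
    a * + p + t                               ∎
    where
    open ≤-Reasoning
    split : ∀ M A P → M * P ≡ - A * P + (M + A) * P
    split = solve-∀

  absorb-below : ∀ m a p {t} → t ≤ - (+ (m ℕ.+ ∣ a ∣) * + p) → a * + p + t ≤ - (+ m * + p)
  absorb-below m a p {t} h = begin
    a * + p + t                                 ≤⟨ +-mono-≤ (*-monoʳ-≤-nonNeg (+ p) (i≤∣i∣ a)) h ⟩
    + ∣ a ∣ * + p + - (+ (m ℕ.+ ∣ a ∣) * + p)   ≡⟨ split (+ m) (+ ∣ a ∣) (+ p) ⟩
    - (+ m * + p)                               ∎
    where
    open ≤-Reasoning
    split : ∀ M A P → A * P + - ((M + A) * P) ≡ - (M * P)
    split = solve-∀

  pow2-mono : ∀ {x x'} → x ℕ.≤ x' → pow2 x ≤ pow2 x'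
  pow2-mono x≤x' = +≤+ (ℕ.^-monoʳ-≤ 2 x≤x')

  pow2-pos : ∀ x → + 1 ≤ pow2 x
  pow2-pos x = +≤+ (ℕ.m^n>0 2 x)

  pow2-+ : ∀ x g → pow2 (x ℕ.+ g) ≡ + (2 ^ g) * pow2 x
  pow2-+ x g = trans (cong +_ (trans (ℕ.^-distribˡ-+-* 2 x g) (ℕ.*-comm (2 ^ x) (2 ^ g))))
                     (pos-* (2 ^ g) (2 ^ x))

  holds⇒≤ : ∀ {M} (k : Constr M) {x' x} → holds k x' x → x ℕ.≤ x'
  holds⇒≤ geM       x+M≤x' = ℕ.m+n≤o⇒m≤o _ x+M≤x'
  holds⇒≤ (eqg g _) refl   = ℕ.m≤m+n _ g

  gap-bound : ∀ {M x' x} m → m ℕ.≤ 2 ^ M → holds (geM {M}) x' x → + m * pow2 x ≤ pow2 x'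
  gap-bound {M} {x'} {x} m m≤2^M gap = begin
    + m * pow2 x         ≤⟨ *-monoʳ-≤-nonNeg (pow2 x) (+≤+ m≤2^M) ⟩
    + (2 ^ M) * pow2 x   ≡⟨ pow2-+ x M ⟨
    pow2 (x ℕ.+ M)       ≤⟨ pow2-mono gap ⟩
    pow2 x'              ∎
    where open ≤-Reasoning

  gap-above : ∀ {M x' x} m {C} → m ℕ.≤ 2 ^ M → holds (geM {M}) x' x → + 1 ≤ C
            → + m * pow2 x ≤ C * pow2 x'
  gap-above {M} {x'} {x} m {C} m≤2^M gap 1≤C = ≤-trans (gap-bound {M} {x'} {x} m m≤2^M gap) (begin
    pow2 x'              ≡⟨ *-identityˡ (pow2 x') ⟨
    + 1 * pow2 x'        ≤⟨ *-monoʳ-≤-nonNeg (pow2 x') 1≤C ⟩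
    C * pow2 x'          ∎)
    where open ≤-Reasoning

  gap-below : ∀ {M x' x} m {C} → m ℕ.≤ 2 ^ M → holds (geM {M}) x' x → C ≤ - + 1
            → C * pow2 x' ≤ - (+ m * pow2 x)
  gap-below {M} {x'} {x} m {C} m≤2^M gap C≤-1 = begin
    C * pow2 x'          ≤⟨ *-monoʳ-≤-nonNeg (pow2 x') C≤-1 ⟩
    - + 1 * pow2 x'      ≡⟨ -1*i≡-i (pow2 x') ⟩
    - pow2 x'            ≤⟨ neg-mono-≤ (gap-bound {M} {x'} {x} m m≤2^M gap) ⟩
    - (+ m * pow2 x)     ∎
    where open ≤-Reasoning

  expSum : ∀ {n} → (Fin (suc n) → ℤ) → (Fin (suc n) → ℕ) → ℤ
  expSum a x = sumℤ (λ i → a i * pow2 (x i))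

  Chain : ∀ {n M} → (Fin n → Constr M) → (Fin (suc n) → ℕ) → Set
  Chain c x = ∀ i → holds (c i) (x (suc i)) (x (inject₁ i))

  data Regime (m : ℕ) {n M} (a : Fin (suc n) → ℤ) (c : Fin n → Constr M) : Set where
    multiple : (C : ℤ) → (∀ x → Chain c x → expSum a x ≡ C * pow2 (x zero)) → Regime m a c
    above    : (∀ x → Chain c x → + m * pow2 (x zero) ≤ expSum a x) → Regime m a c
    below    : (∀ x → Chain c x → expSum a x ≤ - (+ m * pow2 (x zero))) → Regime m a c

  module _ {n M} (m : ℕ) (a : Fin (suc (suc n)) → ℤ) (c : Fin (suc n) → Constr M)
           (fits : m ℕ.+ ∣ a zero ∣ ℕ.≤ 2 ^ M) where

    private
      m' = m ℕ.+ ∣ a zero ∣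

      margin-along-chain : ∀ x → Chain c x → + m' * pow2 (x zero) ≤ + m' * pow2 (x (suc zero))
      margin-along-chain x ch = *-monoˡ-≤-nonNeg (+ m') (pow2-mono (holds⇒≤ (c zero) (ch zero)))

    multiple-cons : (k : Constr M) → (∀ x → Chain c x → holds k (x (suc zero)) (x zero))
                  → (C : ℤ) → (∀ x → Chain (c ∘ suc) x → expSum (a ∘ suc) x ≡ C * pow2 (x zero))
                  → Regime m a c
    multiple-cons (eqg g _) head C f = multiple (a zero + C * + (2 ^ g)) λ x ch → begin
      a zero * pow2 (x zero) + expSum (a ∘ suc) (x ∘ suc)
        ≡⟨ cong (_+_ (a zero * pow2 (x zero))) (f (x ∘ suc) (ch ∘ suc)) ⟩
      a zero * pow2 (x zero) + C * pow2 (x (suc zero))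
        ≡⟨ cong (λ p → a zero * pow2 (x zero) + C * p) (trans (cong pow2 (head x ch)) (pow2-+ (x zero) g)) ⟩
      a zero * pow2 (x zero) + C * (+ (2 ^ g) * pow2 (x zero))
        ≡⟨ collect (a zero) C (+ (2 ^ g)) (pow2 (x zero)) ⟩
      (a zero + C * + (2 ^ g)) * pow2 (x zero) ∎
      where
      open ≡-Reasoning
      collect : ∀ A C G P → A * P + C * (G * P) ≡ (A + C * G) * P
      collect = solve-∀
    multiple-cons geM _ (+ zero) f = multiple (a zero) λ x ch →
      trans (cong (_+_ (a zero * pow2 (x zero))) (f (x ∘ suc) (ch ∘ suc))) (+-identityʳ _)
    multiple-cons geM head C@(+[1+ _ ]) f = above λ x ch →
      absorb-above m (a zero) (2 ^ x zero)
        (subst (+ m' * pow2 (x zero) ≤_) (sym (f (x ∘ suc) (ch ∘ suc)))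
               (gap-above {M} {x (suc zero)} {x zero} m' {C} fits (head x ch) (+≤+ (s≤s z≤n))))
    multiple-cons geM head C@(-[1+ _ ]) f = below λ x ch →
      absorb-below m (a zero) (2 ^ x zero)
        (subst (_≤ - (+ m' * pow2 (x zero))) (sym (f (x ∘ suc) (ch ∘ suc)))
               (gap-below {M} {x (suc zero)} {x zero} m' {C} fits (head x ch) (-≤- z≤n)))

    regime-cons : Regime m' (a ∘ suc) (c ∘ suc) → Regime m a c
    regime-cons (multiple C f) = multiple-cons (c zero) (λ x ch → ch zero) C f
    regime-cons (above f) = above λ x ch →
      absorb-above m (a zero) (2 ^ x zero) (≤-trans (margin-along-chain x ch) (f (x ∘ suc) (ch ∘ suc)))
    regime-cons (below f) = below λ x ch →
      absorb-below m (a zero) (2 ^ x zero) (≤-trans (f (x ∘ suc) (ch ∘ suc)) (neg-mono-≤ (margin-along-chain x ch)))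

  regime : ∀ {M} n m (a : Fin (suc n) → ℤ) (c : Fin n → Constr M)
         → m ℕ.+ sumℕ (λ i → ∣ a i ∣) ℕ.≤ 2 ^ M → Regime m a c
  regime zero    m a c _    = multiple (a zero) λ x _ → +-identityʳ _
  regime {M} (suc n) m a c fits = regime-cons {M = M} m a c (ℕ.m+n≤o⇒m≤o _ fits′)
                                (regime n (m ℕ.+ ∣ a zero ∣) (a ∘ suc) (c ∘ suc) fits′)
    where
    fits′ : m ℕ.+ ∣ a zero ∣ ℕ.+ sumℕ (λ i → ∣ a (suc i) ∣) ℕ.≤ 2 ^ M
    fits′ = subst (ℕ._≤ 2 ^ M) (sym (ℕ.+-assoc m _ _)) fits

  module _ (μ k d p : ℕ) (1≤p : + 1 ≤ + p) where

    private
      b = μ ℕ.* (k ℕ.+ d)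

      d≤d*p : + d ≤ + d * + p
      d≤d*p = begin
        + d         ≡⟨ *-identityʳ (+ d) ⟨
        + d * + 1   ≤⟨ *-monoˡ-≤-nonNeg (+ d) 1≤p ⟩
        + d * + p   ∎
        where open ≤-Reasoning

      b*p≡ : + b * + p ≡ + μ * (+ k * + p) + + μ * (+ d * + p)
      b*p≡ = trans (cong (_* + p) (pos-* μ (k ℕ.+ d))) (distrib (+ μ) (+ k) (+ d) (+ p))
        where
        distrib : ∀ U K D P → U * (K + D) * P ≡ U * (K * P) + U * (D * P)
        distrib = solve-∀

    offset-lower : ∀ {y} → - (+ k * + p) ≤ y → - (+ b * + p) ≤ + μ * y + + μ * + d
    offset-lower {y} -kp≤y = begin
      - (+ b * + p)                               ≡⟨ cong -_ b*p≡ ⟩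
      - (+ μ * (+ k * + p) + + μ * (+ d * + p))   ≡⟨ negate (+ μ) (+ k * + p) (+ d * + p) ⟩
      + μ * - (+ k * + p) + + μ * - (+ d * + p)   ≤⟨ +-mono-≤ (*-monoˡ-≤-nonNeg (+ μ) -kp≤y)
                                                               (*-monoˡ-≤-nonNeg (+ μ) (≤-trans (neg-mono-≤ d≤d*p) neg-≤-pos)) ⟩
      + μ * y + + μ * + d                         ∎
      where
      open ≤-Reasoning
      negate : ∀ U X Y → - (U * X + U * Y) ≡ U * - X + U * - Y
      negate = solve-∀

    offset-upper : ∀ {y} → y ≤ + k * + p → + μ * y + + μ * + d ≤ + b * + p
    offset-upper {y} y≤kp = begin
      + μ * y + + μ * + d                       ≤⟨ +-mono-≤ (*-monoˡ-≤-nonNeg (+ μ) y≤kp) (*-monoˡ-≤-nonNeg (+ μ) d≤d*p) ⟩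
      + μ * (+ k * + p) + + μ * (+ d * + p)     ≡⟨ b*p≡ ⟨
      + b * + p                                 ∎
      where open ≤-Reasoning

    E-positive : ∀ {T y} → + suc b * + p ≤ T → - (+ k * + p) ≤ y → + 1 ≤ T + + μ * y + + μ * + d
    E-positive {T} {y} margin -kp≤y = begin
      + 1                                     ≤⟨ 1≤p ⟩
      + p                                     ≡⟨ peel (+ b) (+ p) ⟩
      + suc b * + p + - (+ b * + p)           ≤⟨ +-mono-≤ margin (offset-lower -kp≤y) ⟩
      T + (+ μ * y + + μ * + d)               ≡⟨ +-assoc T _ _ ⟨
      T + + μ * y + + μ * + d                 ∎
      where
      open ≤-Reasoning
      peel : ∀ B P → P ≡ (+ 1 + B) * P + - (B * P)
      peel = solve-∀

    E-negative : ∀ {T y} → T ≤ - (+ suc b * + p) → y ≤ + k * + p → T + + μ * y + + μ * + d ≤ - + 1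
    E-negative {T} {y} margin y≤kp = begin
      T + + μ * y + + μ * + d                 ≡⟨ +-assoc T _ _ ⟩
      T + (+ μ * y + + μ * + d)               ≤⟨ +-mono-≤ margin (offset-upper y≤kp) ⟩
      - (+ suc b * + p) + + b * + p           ≡⟨ peel (+ b) (+ p) ⟩
      - + p                                   ≤⟨ neg-mono-≤ 1≤p ⟩
      - + 1                                   ∎
      where
      open ≤-Reasoning
      peel : ∀ B P → - ((+ 1 + B) * P) + B * P ≡ - P
      peel = solve-∀

  positive⇒≁0 : ∀ ∼ {e} → + 1 ≤ e → ¬ (e ∼0[ ∼ ])
  positive⇒≁0 le 1≤e e≤0 with ≤-trans 1≤e e≤0
  ... | +≤+ ()
  positive⇒≁0 eq (+≤+ ()) refl

  positive-iff : ∀ ∼ {e} → + 1 ≤ e → (e ∼0[ ∼ ] ⇔ (+ 1) ∼0[ ∼ ])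
  positive-iff ∼ 1≤e = mk⇔ (⊥-elim ∘ positive⇒≁0 ∼ 1≤e) (⊥-elim ∘ positive⇒≁0 ∼ ≤-refl)

  negative-rep : ∀ {b} → Cmp → Expr b
  negative-rep le = const0
  negative-rep eq = const1

  negative-iff : ∀ {n b} μ d (x : Fin (suc n) → ℕ) y ∼ {e} → e ≤ - + 1
               → (e ∼0[ ∼ ] ⇔ evalE' μ d (negative-rep {b} ∼) x y ∼0[ ∼ ])
  negative-iff μ d x y le e≤-1 = mk⇔ (λ _ → ≤-refl) (λ _ → ≤-trans e≤-1 -≤+)
  negative-iff μ d x y eq e≤-1 = mk⇔ (λ { refl → ⊥-elim (0≰-1 e≤-1) }) (λ ())
    where
    0≰-1 : ¬ (+ 0 ≤ - + 1)
    0≰-1 ()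

  Representation : ∀ {n M} → (Fin (suc n) → ℤ) → (μ d k : ℕ) → (Fin n → Constr M) → Cmp → Set
  Representation a μ d k c ∼ = Σ (Expr (μ ℕ.* (k ℕ.+ d))) λ E' →
    ∀ x y → ψ k c x y → (E a μ d x y ∼0[ ∼ ] ⇔ evalE' μ d E' x y ∼0[ ∼ ])

  module _ {n M} (a : Fin (suc n) → ℤ) (μ d k : ℕ) (c : Fin n → Constr M) (∼ : Cmp) where

    private
      b = μ ℕ.* (k ℕ.+ d)

    represent-above : (∀ x → Chain c x → + suc b * pow2 (x zero) ≤ expSum a x)
                    → Representation a μ d k c ∼
    represent-above f = const1 , λ x y ((-kp≤y , _) , ch) →
      positive-iff ∼ (E-positive μ k d (2 ^ x zero) (pow2-pos (x zero)) (f x ch) -kp≤y)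

    represent-below : (∀ x → Chain c x → expSum a x ≤ - (+ suc b * pow2 (x zero)))
                    → Representation a μ d k c ∼
    represent-below f = negative-rep ∼ , λ x y ((_ , y≤kp) , ch) →
      negative-iff μ d x y ∼ (E-negative μ k d (2 ^ x zero) (pow2-pos (x zero)) (f x ch) y≤kp)

    represent : Regime (suc b) a c → Representation a μ d k c ∼
    represent (above f) = represent-above f
    represent (below f) = represent-below f
    represent (multiple C f) with ∣ C ∣ ℕ.≤? b
    ... | yes ∣C∣≤b = lin C (≤-trans (neg-mono-≤ (+≤+ ∣C∣≤b)) (-∣i∣≤i C)) (≤-trans (i≤∣i∣ C) (+≤+ ∣C∣≤b)) ,
      λ x y (_ , ch) → let E≡E' = cong (λ T → T + + μ * y + + μ * + d) (f x ch) in
        mk⇔ (subst (_∼0[ ∼ ]) E≡E') (subst (_∼0[ ∼ ]) (sym E≡E'))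
    ... | no ∣C∣≰b with j≤∣i∣⇒j≤i⊎i≤-j C (ℕ.≰⇒> ∣C∣≰b)
    ...   | inj₁ 1+b≤C  = represent-above λ x ch →
      subst (_ ≤_) (sym (f x ch)) (*-monoʳ-≤-nonNeg (pow2 (x zero)) 1+b≤C)
    ...   | inj₂ C≤-1-b = represent-below λ x ch →
      subst (_≤ _) (sym (f x ch)) (≤-trans (*-monoʳ-≤-nonNeg (pow2 (x zero)) C≤-1-b)
                                           (≤-reflexive (sym (neg-distribˡ-* (+ suc b) (pow2 (x zero))))))

open ExponentBounds using (margin-fits)
open Dominance using (regime; represent)

open import Data.Nat as ℕ using (ℕ; suc; _^_; _≤_; _*_; _+_)
open import Data.Integer as ℤ using (ℤ; ∣_∣)
open import Data.Fin using (Fin)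
open import Data.Product using (Σ)
open import Function.Bundles using (_⇔_)

lemma18 : (n : ℕ) (a : Fin (suc n) → ℤ) (μ d M k : ℕ)
          → 2 * ((sumℕ (λ i → ∣ a i ∣) + k * μ) ^ 2) ≤ 2 ^ M
          → 256 * (μ ^ 4) ≤ 2 ^ M
          → d ≤ M
          → (c : Fin n → Constr M) (∼ : Cmp)
          → Σ (Expr (μ * (k + d))) (λ E' →
              (x : Fin (suc n) → ℕ) (y : ℤ) → ψ k c x y
              → (E a μ d x y ∼0[ ∼ ] ⇔ evalE' μ d E' x y ∼0[ ∼ ]))
lemma18 n a μ d M k fitsS fitsμ d≤M c ∼ =
  represent a μ d k c ∼ (regime n (suc (μ * (k + d))) a c (margin-fits _ μ d M k fitsS fitsμ d≤M))
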